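{- Let $n\ge 1$ and $r\ge 1$ be integers, let $H_{n,r}$ be the complete $r$-uniform hyperstar on $[n]=\{1,\dots,n\}$, and let $p\le q$ be positive integers. Then $$P(H_{n,r};p,q,\mathbf{t})=q^n+\sum_{\substack{S\subseteq[n-1]\\ |S|\ge r-1}}p\,(t_{S+n}-1)\,(q-1)^{n-|S|-1},$$ where $t_{S+n}=\prod_{T:\ n\in T\subseteq S\cup\{n\},\ |T|=r}t_T$.
   Context: $H_{n,r}$ has vertex set $[n]$ and, as edges, each $r$-element subset $T\subseteq[n]$ with $n\in T$ exactly once, carrying an indeterminate $t_T$. For a hypergraph with vertex set $V$ and edge family $(e_i)_{i\in I}$, and positive integers $p\le q$: a $q$-coloring is $f:V\to\{1,\dots,q\}$; colors $1,\dots,p$ are primary; $e_i$ is primary under $f$ if $f(u)=f(v)\le p$ for all $u,v\in e_i$; $P(f)$ is the set of indices of primary edges; and $P(H;p,q,\mathbf{t})=\sum_{f:V\to[q]}\prod_{i\in P(f)}t_i$. -}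

module Defs where

open import Level using (Level)
open import Algebra.Bundles using (CommutativeRing)
open import Data.Nat using (ℕ; zero; suc; _<_; _≤_; _<?_; _≤?_; _∸_)
open import Data.Fin using (Fin; toℕ; fromℕ) renaming (_≟_ to _≟ᶠ_)
open import Data.Fin.Properties using (all?)
open import Data.Fin.Subset using (Subset; _∈_; _∉_; _⊆_; _∪_; ⁅_⁆; ∣_∣; inside; outside)
open import Data.Fin.Subset.Properties using (_∈?_; _⊆?_)
open import Data.Vec using ([]; _∷_)
import Data.Vec.Functional as VF
open import Data.List using (List; []; _∷_; _++_; map; concatMap; filter; foldr; allFin)
open import Data.Product using (_×_)
open import Relation.Binary.PropositionalEquality using (_≡_)
open import Relation.Nullary using (Dec; ¬_)
open import Relation.Nullary.Decidable using (_×-dec_; _→-dec_; ¬?)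
open import Relation.Unary using (Decidable)

allSubsets : (k : ℕ) → List (Subset k)
allSubsets zero = [] ∷ []
allSubsets (suc k) = map (inside ∷_) (allSubsets k) ++ map (outside ∷_) (allSubsets k)

allColorings : (k q : ℕ) → List (Fin k → Fin q)
allColorings zero q = (λ ()) ∷ []
allColorings (suc k) q =
  concatMap (λ c → map (λ g → c VF.∷ g) (allColorings k q)) (allFin q)

-- Primary edges.  Colors 1..p (paper) correspond to Fin-indices 0..p-1,
-- i.e. color c is primary iff toℕ c < p.

Primary : {k q : ℕ} (p : ℕ) (f : Fin k → Fin q) (e : Subset k) → Set
Primary p f e = ∀ u v → u ∈ e → v ∈ e → (f u ≡ f v) × (toℕ (f u) < p)

primary? : {k q : ℕ} (p : ℕ) (f : Fin k → Fin q) → Decidable (Primary p f)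
primary? p f e = all? λ u → all? λ v →
  (u ∈? e) →-dec ((v ∈? e) →-dec ((f u ≟ᶠ f v) ×-dec (toℕ (f u) <? p)))

module _ {c ℓ : Level} (R : CommutativeRing c ℓ) where
  open CommutativeRing R

  ΣL : {A : Set} → List A → (A → Carrier) → Carrier
  ΣL xs g = foldr (λ x acc → g x + acc) 0# xs

  ΠL : {A : Set} → List A → (A → Carrier) → Carrier
  ΠL xs g = foldr (λ x acc → g x * acc) 1# xs

  ℕ→R : ℕ → Carrier
  ℕ→R zero = 0#
  ℕ→R (suc n) = 1# + ℕ→R n

  infixr 8 _^ᴿ_
  _^ᴿ_ : Carrier → ℕ → Carrier
  x ^ᴿ zero = 1#
  x ^ᴿ suc n = x * (x ^ᴿ n)

  -- P(H;p,q,t) for a hypergraph on vertex set Fin k whose edge family is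
  -- (e i) for i ranging over the index list I (each index listed once),
  -- with edge weights t i.
  HPoly : {Idx : Set} (k : ℕ) (I : List Idx) (e : Idx → Subset k)
          (p q : ℕ) (t : Idx → Carrier) → Carrier
  HPoly k I e p q t =
    ΣL (allColorings k q) λ f →
      ΠL (filter (λ i → primary? p f (e i)) I) t

-- The complete r-uniform hyperstar H_{n,r} on [n], n = suc m.
-- Vertex j ∈ [n] is Fin-index j-1, so the centre n is  fromℕ m.

IsStarEdge : (m r : ℕ) → Subset (suc m) → Set
IsStarEdge m r T = (fromℕ m ∈ T) × (∣ T ∣ ≡ r)

isStarEdge? : (m r : ℕ) → Decidable (IsStarEdge m r)
isStarEdge? m r T = (fromℕ m ∈? T) ×-dec (∣ T ∣ Data.Nat.≟ r)

starEdges : (m r : ℕ) → List (Subset (suc m))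
starEdges m r = filter (isStarEdge? m r) (allSubsets (suc m))

IsIndexSet : (m r : ℕ) → Subset (suc m) → Set
IsIndexSet m r S = (fromℕ m ∉ S) × (r ∸ 1 ≤ ∣ S ∣)

isIndexSet? : (m r : ℕ) → Decidable (IsIndexSet m r)
isIndexSet? m r S = ¬? (fromℕ m ∈? S) ×-dec (r ∸ 1 ≤? ∣ S ∣)

indexSets : (m r : ℕ) → List (Subset (suc m))
indexSets m r = filter (isIndexSet? m r) (allSubsets (suc m))

module _ {c ℓ : Level} (R : CommutativeRing c ℓ) where
  open CommutativeRing R

  tPlus : (m r : ℕ) (t : Subset (suc m) → Carrier) (S : Subset (suc m)) → Carrier
  tPlus m r t S =
    ΠL R (filter (λ T → T ⊆? (S ∪ ⁅ fromℕ m ⁆)) (starEdges m r)) t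

-- A colouring g contributes t_{S+n} when the centre n gets a primary colour, S being the set of
-- other vertices coloured like n, and contributes 1 when the colour of n is not primary. With the
-- colour of n and S fixed, each of the n-1-|S| vertices outside S ∪ {n} may take any of the other
-- q-1 colours, so P(H_{n,r}) = Σ_{S ⊆ [n-1]} (p t_{S+n} + (q-p)) (q-1)^{n-1-|S|}. The theorem
-- follows from Σ_{S ⊆ [n-1]} (q-1)^{n-1-|S|} = q^{n-1} and t_{S+n} = 1 when |S| < r-1.
module Submission where

open import Defs
open import Level using (Level)
open import Algebra.Bundles using (CommutativeRing)
open import Data.Nat using (ℕ; suc; _≤_; _∸_)
open import Data.Fin.Subset using (Subset; ∣_∣)

open import Data.Nat as ℕ using (zero; _<_; _<?_; _≤?_; z≤n; s≤s)
import Data.Nat.Properties as ℕ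
open import Data.Fin using (Fin; toℕ; fromℕ; punchIn; _≟_)
open import Data.Fin.Properties using (punchInᵢ≢i)
open import Data.Fin.Subset using (_∈_; _∉_; _⊆_; _∪_; ⁅_⁆; inside; outside)
open import Data.Fin.Subset.Properties
  using (_∈?_; _⊆?_; drop-there; x∈⁅x⁆; x∈⁅y⁆⇒x≡y; x∈p∪q⁻; x∈p∪q⁺; p⊆q⇒∣p∣≤∣q∣; ∣⁅x⁆∣≡1)
open import Data.Vec using ([]; _∷_; here; there)
import Data.Vec.Functional as Vector
open import Data.List using (List; []; _∷_; _++_; map; concatMap; filter; allFin; tabulate)
open import Data.List.Properties using (filter-++; filter-≐; filter-none)
open import Data.List.Relation.Unary.All as All using (All; []; _∷_)
open import Data.List.Relation.Unary.All.Properties using (all-filter)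
open import Data.Product using (_,_; proj₁; proj₂)
open import Data.Sum using (inj₁; inj₂)
open import Function using (_∘_; _⇔_; mk⇔; Equivalence)
open import Relation.Binary.PropositionalEquality as ≡ using (_≡_; _≢_; _≗_; cong)
open import Relation.Nullary using (Dec; yes; no; does; ¬_; contradiction)
open import Relation.Nullary.Decidable using (_×-dec_; ¬?; dec-true; dec-false)
open import Data.Bool using (Bool; true; false; if_then_else_)
open import Relation.Unary using (Pred; Decidable)

filter-map : ∀ {a b p} {A : Set a} {B : Set b} {P : Pred B p} (P? : Decidable P) (f : A → B) →
             filter P? ∘ map f ≗ map f ∘ filter (P? ∘ f)
filter-map P? f [] = ≡.refl
filter-map P? f (x ∷ xs) with P? (f x)
... | yes _ = cong (f x ∷_) (filter-map P? f xs)
... | no _  = filter-map P? f xs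

module _ {a p q} {A : Set a} {P : Pred A p} {Q : Pred A q} (P? : Decidable P) (Q? : Decidable Q) where

  filter-cong-All : ∀ {xs} → All (λ x → P x ⇔ Q x) xs → filter P? xs ≡ filter Q? xs
  filter-cong-All {[]}     []              = ≡.refl
  filter-cong-All {x ∷ xs} (P⇔Q ∷ P⇔Q-xs) with P? x | Q? x
  ... | yes _  | yes _  = cong (x ∷_) (filter-cong-All P⇔Q-xs)
  ... | no _   | no _   = filter-cong-All P⇔Q-xs
  ... | yes Px | no ¬Qx = contradiction (Equivalence.to P⇔Q Px) ¬Qx
  ... | no ¬Px | yes Qx = contradiction (Equivalence.from P⇔Q Qx) ¬Px

  filter-×-dec : filter (λ x → P? x ×-dec Q? x) ≗ filter Q? ∘ filter P?
  filter-×-dec [] = ≡.refl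
  filter-×-dec (x ∷ xs) with P? x
  ... | no _  = filter-×-dec xs
  ... | yes _ with Q? x
  ...   | yes _ = cong (x ∷_) (filter-×-dec xs)
  ...   | no _  = filter-×-dec xs

∣p∪q∣≤∣p∣+∣q∣ : ∀ {n} (p q : Subset n) → ∣ p ∪ q ∣ ≤ ∣ p ∣ ℕ.+ ∣ q ∣
∣p∪q∣≤∣p∣+∣q∣ []            []            = z≤n
∣p∪q∣≤∣p∣+∣q∣ (inside ∷ p)  (inside ∷ q)  =
  s≤s (ℕ.≤-trans (∣p∪q∣≤∣p∣+∣q∣ p q) (ℕ.+-monoʳ-≤ ∣ p ∣ (ℕ.n≤1+n ∣ q ∣)))
∣p∪q∣≤∣p∣+∣q∣ (inside ∷ p)  (outside ∷ q) = s≤s (∣p∪q∣≤∣p∣+∣q∣ p q)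
∣p∪q∣≤∣p∣+∣q∣ (outside ∷ p) (inside ∷ q)  =
  ℕ.≤-trans (s≤s (∣p∪q∣≤∣p∣+∣q∣ p q)) (ℕ.≤-reflexive (≡.sym (ℕ.+-suc ∣ p ∣ ∣ q ∣)))
∣p∪q∣≤∣p∣+∣q∣ (outside ∷ p) (outside ∷ q) = ∣p∪q∣≤∣p∣+∣q∣ p q

fromℕ∉⇒∣p∣≤n : ∀ n {p : Subset (suc n)} → fromℕ n ∉ p → ∣ p ∣ ≤ n
fromℕ∉⇒∣p∣≤n zero    {inside ∷ []}  n∉p = contradiction here n∉p
fromℕ∉⇒∣p∣≤n zero    {outside ∷ []} n∉p = z≤n
fromℕ∉⇒∣p∣≤n (suc n) {inside ∷ p}   n∉p = s≤s (fromℕ∉⇒∣p∣≤n n (n∉p ∘ there))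
fromℕ∉⇒∣p∣≤n (suc n) {outside ∷ p}  n∉p = ℕ.m≤n⇒m≤1+n (fromℕ∉⇒∣p∣≤n n (n∉p ∘ there))

fromℕ∉? : ∀ m → Decidable (λ (S : Subset (suc m)) → fromℕ m ∉ S)
fromℕ∉? m S = ¬? (fromℕ m ∈? S)

nonCentre : (m : ℕ) → List (Subset (suc m))
nonCentre m = filter (fromℕ∉? m) (allSubsets (suc m))

nonCentre-suc : ∀ m →
  nonCentre (suc m) ≡ map (inside ∷_) (nonCentre m) ++ map (outside ∷_) (nonCentre m)
nonCentre-suc m = ≡.trans (filter-++ (fromℕ∉? (suc m)) (map (inside ∷_) Sets) (map (outside ∷_) Sets))
                          (≡.cong₂ _++_ (prepend inside) (prepend outside))
  where
  Sets : List (Subset (suc m))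
  Sets = allSubsets (suc m)
  prepend : ∀ side → filter (fromℕ∉? (suc m)) (map (side ∷_) Sets) ≡ map (side ∷_) (nonCentre m)
  prepend side = ≡.trans (filter-map (fromℕ∉? (suc m)) (side ∷_) Sets)
    (cong (map (side ∷_)) (filter-≐ _ (fromℕ∉? m) ((_∘ there) , (_∘ drop-there)) Sets))

centreClass : ∀ {q} m → (Fin (suc m) → Fin q) → Subset (suc m)
centreClass zero    g = outside ∷ []
centreClass (suc m) g = does (g Fin.zero ≟ g (fromℕ (suc m))) ∷ centreClass m (g ∘ Fin.suc)

∈centreClass⇒ : ∀ {q} m (g : Fin (suc m) → Fin q) {u} →
                u ∈ centreClass m g → g u ≡ g (fromℕ m)
∈centreClass⇒ zero    g {Fin.zero}  ()
∈centreClass⇒ (suc m) g {Fin.zero}  u∈ with g Fin.zero ≟ g (fromℕ (suc m))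
... | yes g0≡gc = g0≡gc
∈centreClass⇒ (suc m) g {Fin.zero}  () | no _
∈centreClass⇒ (suc m) g {Fin.suc u} u∈ = ∈centreClass⇒ m (g ∘ Fin.suc) (drop-there u∈)

centreClass∋ : ∀ {q} m (g : Fin (suc m) → Fin q) {u} →
               u ≢ fromℕ m → g u ≡ g (fromℕ m) → u ∈ centreClass m g
centreClass∋ zero    g {Fin.zero}  u≢c _ = contradiction ≡.refl u≢c
centreClass∋ (suc m) g {Fin.zero}  u≢c gu≡gc with g Fin.zero ≟ g (fromℕ (suc m))
... | yes _   = here
... | no g0≢gc = contradiction gu≡gc g0≢gc
centreClass∋ (suc m) g {Fin.suc u} u≢c gu≡gc =
  there (centreClass∋ m (g ∘ Fin.suc) (u≢c ∘ cong Fin.suc) gu≡gc)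

∈centreClass∪centre⇔ : ∀ {q} m (g : Fin (suc m) → Fin q) {u} →
                       u ∈ centreClass m g ∪ ⁅ fromℕ m ⁆ ⇔ g u ≡ g (fromℕ m)
∈centreClass∪centre⇔ m g {u} = mk⇔ to from
  where
  to : u ∈ centreClass m g ∪ ⁅ fromℕ m ⁆ → g u ≡ g (fromℕ m)
  to u∈ with x∈p∪q⁻ (centreClass m g) ⁅ fromℕ m ⁆ u∈
  ... | inj₁ u∈class  = ∈centreClass⇒ m g u∈class
  ... | inj₂ u∈centre = cong g (x∈⁅y⁆⇒x≡y (fromℕ m) u∈centre)
  from : g u ≡ g (fromℕ m) → u ∈ centreClass m g ∪ ⁅ fromℕ m ⁆
  from gu≡gc with u ≟ fromℕ m
  ... | yes ≡.refl = x∈p∪q⁺ (inj₂ (x∈⁅x⁆ (fromℕ m)))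
  ... | no u≢c     = x∈p∪q⁺ (inj₁ (centreClass∋ m g u≢c gu≡gc))

module _ {q} (m : ℕ) (p : ℕ) (g : Fin (suc m) → Fin q) where

  primary⇔⊆centreClass : toℕ (g (fromℕ m)) < p → ∀ {T} → fromℕ m ∈ T →
                         Primary p g T ⇔ T ⊆ centreClass m g ∪ ⁅ fromℕ m ⁆
  primary⇔⊆centreClass gc<p {T} c∈T = mk⇔ to from
    where
    sameColour : ∀ {u} → u ∈ centreClass m g ∪ ⁅ fromℕ m ⁆ → g u ≡ g (fromℕ m)
    sameColour = Equivalence.to (∈centreClass∪centre⇔ m g)
    inClass : ∀ {u} → g u ≡ g (fromℕ m) → u ∈ centreClass m g ∪ ⁅ fromℕ m ⁆
    inClass = Equivalence.from (∈centreClass∪centre⇔ m g)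
    to : Primary p g T → T ⊆ centreClass m g ∪ ⁅ fromℕ m ⁆
    to prim u∈T = inClass (proj₁ (prim _ _ u∈T c∈T))
    from : T ⊆ centreClass m g ∪ ⁅ fromℕ m ⁆ → Primary p g T
    from T⊆ u v u∈T v∈T =
      ≡.trans (sameColour (T⊆ u∈T)) (≡.sym (sameColour (T⊆ v∈T))) ,
      ≡.subst (λ a → toℕ a < p) (≡.sym (sameColour (T⊆ u∈T))) gc<p

  primaryStarEdges : ∀ r → toℕ (g (fromℕ m)) < p →
    filter (primary? p g) (starEdges m r)
      ≡ filter (_⊆? centreClass m g ∪ ⁅ fromℕ m ⁆) (starEdges m r)
  primaryStarEdges r gc<p = filter-cong-All (primary? p g) (_⊆? centreClass m g ∪ ⁅ fromℕ m ⁆)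
    (All.map (primary⇔⊆centreClass gc<p ∘ proj₁) (all-filter (isStarEdge? m r) (allSubsets (suc m))))

  noPrimaryStarEdges : ∀ r → ¬ toℕ (g (fromℕ m)) < p → filter (primary? p g) (starEdges m r) ≡ []
  noPrimaryStarEdges r gc≮p = filter-none (primary? p g)
    (All.map (λ (c∈T , _) prim → gc≮p (proj₂ (prim _ _ c∈T c∈T)))
             (all-filter (isStarEdge? m r) (allSubsets (suc m))))

noStarEdges⊆ : ∀ m r {S : Subset (suc m)} → ¬ (r ∸ 1 ≤ ∣ S ∣) →
               filter (_⊆? S ∪ ⁅ fromℕ m ⁆) (starEdges m r) ≡ []
noStarEdges⊆ m r {S} small = filter-none (_⊆? S ∪ ⁅ fromℕ m ⁆)
  (All.map notContained (all-filter (isStarEdge? m r) (allSubsets (suc m))))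
  where
  r∸1≤∣S∣ : r ≤ ∣ S ∪ ⁅ fromℕ m ⁆ ∣ → r ∸ 1 ≤ ∣ S ∣
  r∸1≤∣S∣ r≤ = begin
    r ∸ 1                         ≤⟨ ℕ.∸-monoˡ-≤ 1 (ℕ.≤-trans r≤ (∣p∪q∣≤∣p∣+∣q∣ S ⁅ fromℕ m ⁆)) ⟩
    (∣ S ∣ ℕ.+ ∣ ⁅ fromℕ m ⁆ ∣) ∸ 1 ≡⟨ cong (λ k → (∣ S ∣ ℕ.+ k) ∸ 1) (∣⁅x⁆∣≡1 (fromℕ m)) ⟩
    (∣ S ∣ ℕ.+ 1) ∸ 1              ≡⟨ ℕ.m+n∸n≡m ∣ S ∣ 1 ⟩
    ∣ S ∣                          ∎
    where open ℕ.≤-Reasoning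
  notContained : ∀ {T} → IsStarEdge m r T → ¬ (T ⊆ S ∪ ⁅ fromℕ m ⁆)
  notContained (_ , ∣T∣≡r) T⊆ =
    small (r∸1≤∣S∣ (≡.subst (_≤ ∣ S ∪ ⁅ fromℕ m ⁆ ∣) ∣T∣≡r (p⊆q⇒∣p∣≤∣q∣ T⊆)))

module StarPolynomial {c ℓ} (R : CommutativeRing c ℓ) where

  open CommutativeRing R hiding (zero)
  open import Algebra.Properties.Ring ring
    using (-0#≈0#; -‿+-comm; -‿distribˡ-*; xyx⁻¹≈y; x[y-z]≈xy-xz)
  open import Algebra.Properties.CommutativeSemigroup +-commutativeSemigroup using (interchange)
  open import Algebra.Properties.CommutativeSemigroup *-commutativeSemigroup using (x∙yz≈y∙xz)
  open import Algebra.Properties.CommutativeMonoid.Sum +-commutativeMonoid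
    using (sum; sum-remove; sum-cong-≗; sum-replicate)
  open import Algebra.Properties.Semiring.Mult semiring using (_×_; ×-congʳ; ×-assoc-*)
  open import Relation.Binary.Reasoning.Setoid setoid

  infixr 8 _^_
  _^_ : Carrier → ℕ → Carrier
  _^_ = _^ᴿ_ R

  ^-congˡ : ∀ n {x y} → x ≈ y → x ^ n ≈ y ^ n
  ^-congˡ zero    x≈y = refl
  ^-congˡ (suc n) x≈y = *-cong x≈y (^-congˡ n x≈y)

  private
    variable
      A B : Set

  Σ : List A → (A → Carrier) → Carrier
  Σ = ΣL R

  Σ-cong : ∀ (xs : List A) {f g : A → Carrier} → (∀ a → f a ≈ g a) → Σ xs f ≈ Σ xs g
  Σ-cong []       f≈g = refl
  Σ-cong (x ∷ xs) f≈g = +-cong (f≈g x) (Σ-cong xs f≈g)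

  Σ-++ : ∀ (xs ys : List A) f → Σ (xs ++ ys) f ≈ Σ xs f + Σ ys f
  Σ-++ []       ys f = sym (+-identityˡ _)
  Σ-++ (x ∷ xs) ys f = trans (+-congˡ (Σ-++ xs ys f)) (sym (+-assoc _ _ _))

  Σ-+ : ∀ (xs : List A) f g → Σ xs (λ a → f a + g a) ≈ Σ xs f + Σ xs g
  Σ-+ []       f g = sym (+-identityʳ 0#)
  Σ-+ (x ∷ xs) f g = trans (+-congˡ (Σ-+ xs f g)) (interchange _ _ _ _)

  Σ-*ˡ : ∀ (xs : List A) k f → Σ xs (λ a → k * f a) ≈ k * Σ xs f
  Σ-*ˡ []       k f = sym (zeroʳ k)
  Σ-*ˡ (x ∷ xs) k f = trans (+-congˡ (Σ-*ˡ xs k f)) (sym (distribˡ k _ _))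

  Σ-neg : ∀ (xs : List A) f → Σ xs (λ a → - f a) ≈ - Σ xs f
  Σ-neg []       f = sym -0#≈0#
  Σ-neg (x ∷ xs) f = trans (+-congˡ (Σ-neg xs f)) (-‿+-comm _ _)

  Σ-0# : ∀ (xs : List A) → Σ xs (λ _ → 0#) ≈ 0#
  Σ-0# []       = refl
  Σ-0# (x ∷ xs) = trans (+-congˡ (Σ-0# xs)) (+-identityʳ 0#)

  Σ-comm : ∀ (xs : List A) (ys : List B) (h : A → B → Carrier) →
           Σ xs (λ a → Σ ys (h a)) ≈ Σ ys (λ b → Σ xs (λ a → h a b))
  Σ-comm []       ys h = sym (Σ-0# ys)
  Σ-comm (x ∷ xs) ys h = trans (+-congˡ (Σ-comm xs ys h)) (sym (Σ-+ ys (h x) _))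

  Σ-map : ∀ (f : B → A) xs g → Σ (map f xs) g ≈ Σ xs (g ∘ f)
  Σ-map f []       g = refl
  Σ-map f (x ∷ xs) g = +-congˡ (Σ-map f xs g)

  Σ-concatMap : ∀ (f : B → List A) xs g → Σ (concatMap f xs) g ≈ Σ xs (λ b → Σ (f b) g)
  Σ-concatMap f []       g = refl
  Σ-concatMap f (x ∷ xs) g = trans (Σ-++ (f x) _ g) (+-congˡ (Σ-concatMap f xs g))

  module _ {p} {P : Pred A p} (P? : Decidable P) where

    Σ-filter-cong : ∀ xs {f g : A → Carrier} → (∀ a → P a → f a ≈ g a) →
                    Σ (filter P? xs) f ≈ Σ (filter P? xs) g
    Σ-filter-cong []       f≈g = refl
    Σ-filter-cong (x ∷ xs) f≈g with P? x
    ... | yes Px = +-cong (f≈g x Px) (Σ-filter-cong xs f≈g)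
    ... | no _   = Σ-filter-cong xs f≈g

    Σ-filter-support : ∀ xs {f : A → Carrier} → (∀ a → ¬ P a → f a ≈ 0#) →
                       Σ (filter P? xs) f ≈ Σ xs f
    Σ-filter-support []       f≈0 = refl
    Σ-filter-support (x ∷ xs) f≈0 with P? x
    ... | yes _   = +-congˡ (Σ-filter-support xs f≈0)
    ... | no ¬Px  = trans (Σ-filter-support xs f≈0) (sym (trans (+-congʳ (f≈0 x ¬Px)) (+-identityˡ _)))

  ℕ→R≡×1# : ∀ n → ℕ→R R n ≡ n × 1#
  ℕ→R≡×1# zero    = ≡.refl
  ℕ→R≡×1# (suc n) = cong (1# +_) (ℕ→R≡×1# n)

  ×≈ℕ→R* : ∀ n v → n × v ≈ ℕ→R R n * v
  ×≈ℕ→R* n v = begin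
    n × v          ≈⟨ ×-congʳ n (*-identityˡ v) ⟨
    n × (1# * v)   ≈⟨ ×-assoc-* n 1# v ⟨
    (n × 1#) * v   ≡⟨ cong (_* v) (ℕ→R≡×1# n) ⟨
    ℕ→R R n * v    ∎

  ℕ→R-+ : ∀ m n → ℕ→R R (m ℕ.+ n) ≈ ℕ→R R m + ℕ→R R n
  ℕ→R-+ zero    n = sym (+-identityˡ _)
  ℕ→R-+ (suc m) n = trans (+-congˡ (ℕ→R-+ m n)) (sym (+-assoc _ _ _))

  Σ-allFin : ∀ n (f : Fin n → Carrier) → Σ (allFin n) f ≡ sum f
  Σ-allFin n f = Σ-tabulate n (λ a → a)
    where
    Σ-tabulate : ∀ k (h : Fin k → Fin n) → Σ (tabulate h) f ≡ sum (f ∘ h)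
    Σ-tabulate zero    h = ≡.refl
    Σ-tabulate (suc k) h = cong (f (h Fin.zero) +_) (Σ-tabulate k (h ∘ Fin.suc))

  countEqual : ∀ n (k : Bool → Carrier) (a : Fin (suc n)) →
               Σ (allFin (suc n)) (λ b → k (does (b ≟ a))) ≈ k true + ℕ→R R n * k false
  countEqual n k a = begin
    Σ (allFin (suc n)) t              ≡⟨ Σ-allFin (suc n) t ⟩
    sum t                             ≈⟨ sum-remove {i = a} t ⟩
    t a + sum (t ∘ punchIn a)         ≡⟨ ≡.cong₂ _+_ (cong k (dec-true (a ≟ a) ≡.refl))
                                                     (sum-cong-≗ others) ⟩
    k true + sum {n} (λ _ → k false)  ≈⟨ +-congˡ (sum-replicate n) ⟩
    k true + n × k false              ≈⟨ +-congˡ (×≈ℕ→R* n (k false)) ⟩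
    k true + ℕ→R R n * k false        ∎
    where
    t : Fin (suc n) → Carrier
    t b = k (does (b ≟ a))
    others : t ∘ punchIn a ≗ (λ _ → k false)
    others j = cong k (dec-false (punchIn a j ≟ a) (punchInᵢ≢i a j))

  countBelow : ∀ n p → p ≤ n → ∀ u v →
               Σ (allFin n) (λ a → if does (toℕ a <? p) then u else v)
                 ≈ ℕ→R R p * u + ℕ→R R (n ∸ p) * v
  countBelow n p p≤n u v = begin
    Σ (allFin n) below                ≡⟨ Σ-allFin n below ⟩
    sum below                         ≈⟨ sumBelow n p p≤n ⟩
    p × u + (n ∸ p) × v               ≈⟨ +-cong (×≈ℕ→R* p u) (×≈ℕ→R* (n ∸ p) v) ⟩
    ℕ→R R p * u + ℕ→R R (n ∸ p) * v   ∎
    where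
    below : Fin n → Carrier
    below a = if does (toℕ a <? p) then u else v
    -- The inductive steps hold by computation: `i <? 0` reduces to `no`, `suc i <? suc l` to `i <? l`.
    sumBelow : ∀ k l → l ≤ k →
               sum {k} (λ a → if does (toℕ a <? l) then u else v) ≈ l × u + (k ∸ l) × v
    sumBelow zero    zero    _         = sym (+-identityʳ 0#)
    sumBelow (suc k) zero    _         = trans (sum-replicate (suc k)) (sym (+-identityˡ _))
    sumBelow (suc k) (suc l) (s≤s l≤k) = trans (+-congˡ (sumBelow k l l≤k)) (sym (+-assoc _ _ _))

  nonCentreSum : Carrier → (m : ℕ) → (Subset (suc m) → Carrier) → Carrier
  nonCentreSum x m h = Σ (nonCentre m) (λ S → h S * x ^ (m ∸ ∣ S ∣))

  module _ (x : Carrier) (m : ℕ) where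

    nonCentreSum-cong : ∀ {h h′} → (∀ S → h S ≈ h′ S) →
                        nonCentreSum x m h ≈ nonCentreSum x m h′
    nonCentreSum-cong h≈h′ = Σ-cong (nonCentre m) (λ S → *-congʳ (h≈h′ S))

    nonCentreSum-+ : ∀ h h′ →
                     nonCentreSum x m (λ S → h S + h′ S) ≈ nonCentreSum x m h + nonCentreSum x m h′
    nonCentreSum-+ h h′ =
      trans (Σ-cong (nonCentre m) (λ S → distribʳ _ (h S) (h′ S))) (Σ-+ (nonCentre m) _ _)

    nonCentreSum-*ˡ : ∀ k h → nonCentreSum x m (λ S → k * h S) ≈ k * nonCentreSum x m h
    nonCentreSum-*ˡ k h = trans (Σ-cong (nonCentre m) (λ S → *-assoc k (h S) _)) (Σ-*ˡ (nonCentre m) k _)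

    nonCentreSum-- : ∀ h h′ →
                     nonCentreSum x m (λ S → h S - h′ S) ≈ nonCentreSum x m h - nonCentreSum x m h′
    nonCentreSum-- h h′ = begin
      nonCentreSum x m (λ S → h S - h′ S)
        ≈⟨ nonCentreSum-+ h (λ S → - h′ S) ⟩
      nonCentreSum x m h + nonCentreSum x m (-_ ∘ h′)
        ≈⟨ +-congˡ (Σ-cong (nonCentre m) (λ S → sym (-‿distribˡ-* (h′ S) _))) ⟩
      nonCentreSum x m h + Σ (nonCentre m) (λ S → - (h′ S * x ^ (m ∸ ∣ S ∣)))
        ≈⟨ +-congˡ (Σ-neg (nonCentre m) _) ⟩
      nonCentreSum x m h - nonCentreSum x m h′ ∎

    Σ-nonCentreSum : ∀ (xs : List A) (h : A → Subset (suc m) → Carrier) →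
                     Σ xs (λ a → nonCentreSum x m (h a)) ≈ nonCentreSum x m (λ S → Σ xs (λ a → h a S))
    Σ-nonCentreSum xs h = trans (Σ-comm xs (nonCentre m) _) (Σ-cong (nonCentre m) pullOutWeight)
      where
      pullOutWeight : ∀ S → Σ xs (λ a → h a S * x ^ (m ∸ ∣ S ∣)) ≈ Σ xs (λ a → h a S) * x ^ (m ∸ ∣ S ∣)
      pullOutWeight S = trans (Σ-cong xs (λ a → *-comm (h a S) _)) (trans (Σ-*ˡ xs _ _) (*-comm _ _))

  nonCentreSum-suc : ∀ x m h →
    nonCentreSum x (suc m) h ≈ nonCentreSum x m (λ S → h (inside ∷ S) + x * h (outside ∷ S))
  nonCentreSum-suc x m h = begin
    nonCentreSum x (suc m) h
      ≡⟨ cong (λ Ss → Σ Ss w) (nonCentre-suc m) ⟩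
    Σ (map (inside ∷_) (nonCentre m) ++ map (outside ∷_) (nonCentre m)) w
      ≈⟨ Σ-++ (map (inside ∷_) (nonCentre m)) _ w ⟩
    Σ (map (inside ∷_) (nonCentre m)) w + Σ (map (outside ∷_) (nonCentre m)) w
      ≈⟨ +-cong (Σ-map (inside ∷_) (nonCentre m) w) (Σ-map (outside ∷_) (nonCentre m) w) ⟩
    nonCentreSum x m (h ∘ (inside ∷_)) + Σ (nonCentre m) (λ S → h (outside ∷ S) * x ^ (suc m ∸ ∣ S ∣))
      ≈⟨ +-congˡ (Σ-filter-cong (fromℕ∉? m) (allSubsets (suc m)) oneMoreOutside) ⟩
    nonCentreSum x m (h ∘ (inside ∷_)) + Σ (nonCentre m) (λ S → x * (h (outside ∷ S) * x ^ (m ∸ ∣ S ∣)))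
      ≈⟨ +-congˡ (Σ-*ˡ (nonCentre m) x _) ⟩
    nonCentreSum x m (h ∘ (inside ∷_)) + x * nonCentreSum x m (h ∘ (outside ∷_))
      ≈⟨ +-congˡ (nonCentreSum-*ˡ x m x (h ∘ (outside ∷_))) ⟨
    nonCentreSum x m (h ∘ (inside ∷_)) + nonCentreSum x m (λ S → x * h (outside ∷ S))
      ≈⟨ nonCentreSum-+ x m _ _ ⟨
    nonCentreSum x m (λ S → h (inside ∷ S) + x * h (outside ∷ S)) ∎
    where
    w : Subset (suc (suc m)) → Carrier
    w S = h S * x ^ (suc m ∸ ∣ S ∣)
    oneMoreOutside : ∀ S → fromℕ m ∉ S →
                     h (outside ∷ S) * x ^ (suc m ∸ ∣ S ∣) ≈ x * (h (outside ∷ S) * x ^ (m ∸ ∣ S ∣))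
    oneMoreOutside S c∉S = begin
      h (outside ∷ S) * x ^ (suc m ∸ ∣ S ∣)
        ≡⟨ cong (λ e → h (outside ∷ S) * x ^ e) (ℕ.+-∸-assoc 1 (fromℕ∉⇒∣p∣≤n m c∉S)) ⟩
      h (outside ∷ S) * (x * x ^ (m ∸ ∣ S ∣))
        ≈⟨ x∙yz≈y∙xz _ x _ ⟩
      x * (h (outside ∷ S) * x ^ (m ∸ ∣ S ∣)) ∎

  nonCentreSum-1# : ∀ x m → nonCentreSum x m (λ _ → 1#) ≈ (1# + x) ^ m
  nonCentreSum-1# x zero    = trans (+-identityʳ _) (*-identityʳ 1#)
  nonCentreSum-1# x (suc m) = begin
    nonCentreSum x (suc m) (λ _ → 1#)
      ≈⟨ nonCentreSum-suc x m (λ _ → 1#) ⟩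
    nonCentreSum x m (λ _ → 1# + x * 1#)
      ≈⟨ nonCentreSum-cong x m (λ _ → trans (+-congˡ (*-identityʳ x)) (sym (*-identityʳ _))) ⟩
    nonCentreSum x m (λ _ → (1# + x) * 1#)
      ≈⟨ nonCentreSum-*ˡ x m (1# + x) (λ _ → 1#) ⟩
    (1# + x) * nonCentreSum x m (λ _ → 1#)
      ≈⟨ *-congˡ (nonCentreSum-1# x m) ⟩
    (1# + x) ^ suc m ∎

  colouringSum : ∀ q m (F : Fin (suc q) → Subset (suc m) → Carrier) →
                 Σ (allColorings (suc m) (suc q)) (λ g → F (g (fromℕ m)) (centreClass m g))
                   ≈ Σ (allFin (suc q)) (λ a → nonCentreSum (ℕ→R R q) m (F a))
  colouringSum q zero F =
    trans (Σ-concatMap (λ b → map (b Vector.∷_) (allColorings 0 (suc q))) (allFin (suc q)) _)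
          (Σ-cong (allFin (suc q)) (λ a → +-congʳ (sym (*-identityʳ _))))
  colouringSum q (suc m) F = begin
    Σ (concatMap (λ b → map (b Vector.∷_) colourings) colours) G
      ≈⟨ Σ-concatMap (λ b → map (b Vector.∷_) colourings) colours G ⟩
    Σ colours (λ b → Σ (map (b Vector.∷_) colourings) G)
      ≈⟨ Σ-cong colours (λ b → Σ-map (b Vector.∷_) colourings G) ⟩
    Σ colours (λ b → Σ colourings (λ g → G (b Vector.∷ g)))
      ≈⟨ Σ-comm colours colourings _ ⟩
    Σ colourings (λ g → Σ colours (λ b → G (b Vector.∷ g)))
      ≈⟨ Σ-cong colourings (λ g → countEqual q (joinCentre g) (g (fromℕ m))) ⟩
    Σ colourings (λ g → F′ (g (fromℕ m)) (centreClass m g))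
      ≈⟨ colouringSum q m F′ ⟩
    Σ colours (λ a → nonCentreSum x m (F′ a))
      ≈⟨ Σ-cong colours (λ a → nonCentreSum-suc x m (F a)) ⟨
    Σ colours (λ a → nonCentreSum x (suc m) (F a)) ∎
    where
    x : Carrier
    x = ℕ→R R q
    colours : List (Fin (suc q))
    colours = allFin (suc q)
    colourings : List (Fin (suc m) → Fin (suc q))
    colourings = allColorings (suc m) (suc q)
    G : (Fin (suc (suc m)) → Fin (suc q)) → Carrier
    G g = F (g (fromℕ (suc m))) (centreClass (suc m) g)
    -- Vertex 0 is never the centre: it joins the centre's class for one of its q+1 colours.
    joinCentre : (Fin (suc m) → Fin (suc q)) → Bool → Carrier
    joinCentre g side = F (g (fromℕ m)) (side ∷ centreClass m g)
    F′ : Fin (suc q) → Subset (suc m) → Carrier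
    F′ a S = F a (inside ∷ S) + x * F a (outside ∷ S)

  colourWeight : ∀ {q} m r p → (Subset (suc m) → Carrier) → Fin q → Subset (suc m) → Carrier
  colourWeight m r p t a S = if does (toℕ a <? p) then tPlus R m r t S else 1#

  primaryWeight : ∀ {q} m r p t (g : Fin (suc m) → Fin q) →
                  ΠL R (filter (primary? p g) (starEdges m r)) t
                    ≡ colourWeight m r p t (g (fromℕ m)) (centreClass m g)
  primaryWeight m r p t g = byCentreColour (toℕ (g (fromℕ m)) <? p)
    where
    byCentreColour : (gc<p? : Dec (toℕ (g (fromℕ m)) < p)) →
      ΠL R (filter (primary? p g) (starEdges m r)) t
        ≡ (if does gc<p? then tPlus R m r t (centreClass m g) else 1#)
    byCentreColour (yes gc<p) = cong (λ Ts → ΠL R Ts t) (primaryStarEdges m p g r gc<p)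
    byCentreColour (no gc≮p)  = cong (λ Ts → ΠL R Ts t) (noPrimaryStarEdges m p g r gc≮p)

  HPoly-hyperstar : ∀ m r p q t → p ≤ suc q →
    HPoly R (suc m) (starEdges m r) (λ T → T) p (suc q) t
      ≈ ℕ→R R p * nonCentreSum (ℕ→R R q) m (tPlus R m r t)
        + ℕ→R R (suc q ∸ p) * nonCentreSum (ℕ→R R q) m (λ _ → 1#)
  HPoly-hyperstar m r p q t p≤q = begin
    Σ colourings (λ g → ΠL R (filter (primary? p g) (starEdges m r)) t)
      ≈⟨ Σ-cong colourings (λ g → reflexive (primaryWeight m r p t g)) ⟩
    Σ colourings (λ g → W (g (fromℕ m)) (centreClass m g))
      ≈⟨ colouringSum q m W ⟩
    Σ colours (λ a → nonCentreSum x m (W a))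
      ≈⟨ Σ-nonCentreSum x m colours W ⟩
    nonCentreSum x m (λ S → Σ colours (λ a → W a S))
      ≈⟨ nonCentreSum-cong x m (λ S → countBelow (suc q) p p≤q (tP S) 1#) ⟩
    nonCentreSum x m (λ S → P * tP S + K * 1#)
      ≈⟨ nonCentreSum-+ x m _ _ ⟩
    nonCentreSum x m (λ S → P * tP S) + nonCentreSum x m (λ _ → K * 1#)
      ≈⟨ +-cong (nonCentreSum-*ˡ x m P tP) (nonCentreSum-*ˡ x m K (λ _ → 1#)) ⟩
    P * nonCentreSum x m tP + K * nonCentreSum x m (λ _ → 1#) ∎
    where
    x P K : Carrier
    x = ℕ→R R q
    P = ℕ→R R p
    K = ℕ→R R (suc q ∸ p)
    tP : Subset (suc m) → Carrier
    tP = tPlus R m r t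
    colours : List (Fin (suc q))
    colours = allFin (suc q)
    colourings : List (Fin (suc m) → Fin (suc q))
    colourings = allColorings (suc m) (suc q)
    W : Fin (suc q) → Subset (suc m) → Carrier
    W = colourWeight m r p t

  indexSetSum : ∀ m r p q t →
    Σ (indexSets m r) (λ S →
        ℕ→R R p * ((tPlus R m r t S - 1#) * (ℕ→R R (suc q) - 1#) ^ (suc m ∸ ∣ S ∣ ∸ 1)))
      ≈ ℕ→R R p * (nonCentreSum (ℕ→R R q) m (tPlus R m r t) - nonCentreSum (ℕ→R R q) m (λ _ → 1#))
  indexSetSum m r p q t = begin
    Σ (indexSets m r) f
      ≡⟨ cong (λ Ss → Σ Ss f) (filter-×-dec (fromℕ∉? m) large? (allSubsets (suc m))) ⟩
    Σ (filter large? (nonCentre m)) f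
      ≈⟨ Σ-filter-support large? (nonCentre m) vanishes ⟩
    Σ (nonCentre m) f
      ≈⟨ Σ-cong (nonCentre m) reshape ⟩
    nonCentreSum x m (λ S → P * (tP S - 1#))
      ≈⟨ nonCentreSum-*ˡ x m P _ ⟩
    P * nonCentreSum x m (λ S → tP S - 1#)
      ≈⟨ *-congˡ (nonCentreSum-- x m tP (λ _ → 1#)) ⟩
    P * (nonCentreSum x m tP - nonCentreSum x m (λ _ → 1#)) ∎
    where
    x P : Carrier
    x = ℕ→R R q
    P = ℕ→R R p
    tP : Subset (suc m) → Carrier
    tP = tPlus R m r t
    large? : Decidable (λ (S : Subset (suc m)) → r ∸ 1 ≤ ∣ S ∣)
    large? S = r ∸ 1 ≤? ∣ S ∣
    weight f : Subset (suc m) → Carrier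
    weight S = (1# + x - 1#) ^ (suc m ∸ ∣ S ∣ ∸ 1)
    f S = P * ((tP S - 1#) * weight S)
    vanishes : ∀ S → ¬ (r ∸ 1 ≤ ∣ S ∣) → f S ≈ 0#
    vanishes S small = begin
      P * ((tP S - 1#) * weight S)  ≡⟨ cong (λ Ts → P * ((ΠL R Ts t - 1#) * weight S)) (noStarEdges⊆ m r small) ⟩
      P * ((1# - 1#) * weight S)    ≈⟨ *-congˡ (*-congʳ (-‿inverseʳ 1#)) ⟩
      P * (0# * weight S)           ≈⟨ *-congˡ (zeroˡ _) ⟩
      P * 0#                        ≈⟨ zeroʳ P ⟩
      0#                            ∎
    exponent : ∀ k → suc m ∸ k ∸ 1 ≡ m ∸ k
    exponent k = ≡.trans (ℕ.∸-+-assoc (suc m) k 1) (cong (suc m ∸_) (ℕ.+-comm k 1))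
    reshape : ∀ S → f S ≈ P * (tP S - 1#) * x ^ (m ∸ ∣ S ∣)
    reshape S = begin
      P * ((tP S - 1#) * (1# + x - 1#) ^ (suc m ∸ ∣ S ∣ ∸ 1))
        ≡⟨ cong (λ e → P * ((tP S - 1#) * (1# + x - 1#) ^ e)) (exponent ∣ S ∣) ⟩
      P * ((tP S - 1#) * (1# + x - 1#) ^ (m ∸ ∣ S ∣))
        ≈⟨ *-congˡ (*-congˡ (^-congˡ (m ∸ ∣ S ∣) (xyx⁻¹≈y 1# x))) ⟩
      P * ((tP S - 1#) * x ^ (m ∸ ∣ S ∣))
        ≈⟨ *-assoc P _ _ ⟨
      P * (tP S - 1#) * x ^ (m ∸ ∣ S ∣) ∎

  regroup : ∀ a b u v → (a + b) * v + a * (u - v) ≈ a * u + b * v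
  regroup a b u v = begin
    (a + b) * v + a * (u - v)            ≈⟨ +-cong (distribʳ v a b) (x[y-z]≈xy-xz a u v) ⟩
    (a * v + b * v) + (a * u - a * v)    ≈⟨ +-assoc (a * v + b * v) (a * u) (- (a * v)) ⟨
    (a * v + b * v) + a * u - a * v      ≈⟨ +-congʳ (+-assoc (a * v) (b * v) (a * u)) ⟩
    a * v + (b * v + a * u) - a * v      ≈⟨ xyx⁻¹≈y (a * v) (b * v + a * u) ⟩
    b * v + a * u                        ≈⟨ +-comm (b * v) (a * u) ⟩
    a * u + b * v                        ∎

mainTheorem11 : {c ℓ : Level} (R : CommutativeRing c ℓ) →
    let open CommutativeRing R in
    (m r p q : ℕ) → 1 ≤ r → 1 ≤ p → p ≤ q →
    (t : Subset (suc m) → Carrier) →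
    HPoly R (suc m) (starEdges m r) (λ T → T) p q t
      ≈ _^ᴿ_ R (ℕ→R R q) (suc m)
        + ΣL R (indexSets m r) (λ S →
            ℕ→R R p * ((tPlus R m r t S - 1#)
              * _^ᴿ_ R (ℕ→R R q - 1#) (suc m ∸ ∣ S ∣ ∸ 1)))
mainTheorem11 R m r p zero    _ (s≤s _) ()
mainTheorem11 R m r p (suc q) _ _       p≤q t = begin
  HPoly R (suc m) (starEdges m r) (λ T → T) p (suc q) t
    ≈⟨ HPoly-hyperstar m r p q t p≤q ⟩
  P * Bt + K * B1
    ≈⟨ regroup P K Bt B1 ⟨
  (P + K) * B1 + P * (Bt - B1)
    ≈⟨ +-cong (*-cong (sym Q≈P+K) (nonCentreSum-1# x m)) (sym (indexSetSum m r p q t)) ⟩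
  ℕ→R R (suc q) ^ suc m + Σ (indexSets m r) _ ∎
  where
  open CommutativeRing R
  open StarPolynomial R
  open import Relation.Binary.Reasoning.Setoid setoid
  x P K Bt B1 : Carrier
  x = ℕ→R R q
  P = ℕ→R R p
  K = ℕ→R R (suc q ∸ p)
  Bt = nonCentreSum x m (tPlus R m r t)
  B1 = nonCentreSum x m (λ _ → 1#)
  Q≈P+K : ℕ→R R (suc q) ≈ P + K
  Q≈P+K = trans (reflexive (cong (ℕ→R R) (≡.sym (ℕ.m+[n∸m]≡n p≤q)))) (ℕ→R-+ p (suc q ∸ p))
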